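{- Let $n\ge2$ and let $A=\{a_1,\ldots,a_m\}$ be integers with $0<a_1<a_2<\cdots<a_m$. Then the $n$-ary system $A$ has the weak uniqueness property if and only if the $n$-ary system $B=\{0,a_2-a_1,\ldots,a_m-a_1\}$ has the uniqueness property.
   Context: For a finite set $D$ of nonnegative integer digits, a $D$-expansion of an integer $k\ge0$ is a tuple $(\alpha_0,\ldots,\alpha_J)$ of elements of $D$ with $k=\sum_{j=0}^J\alpha_jn^j$ and $\alpha_J\neq0$ (for $k=0$, the empty tuple). The system $D$ has the uniqueness property if every integer $k\ge0$ has at most one $D$-expansion. It has the weak uniqueness property if any two distinct $D$-expansions of the same length represent different numbers. -}

module Defs where

open import Data.Nat using (ℕ; zero; suc; _+_; _*_; _∸_; _<_)
open import Data.Fin using (Fin) renaming (zero to fzero; suc to fsuc; _<_ to _<ᶠ_)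
open import Data.List using (List; []; _∷_; length)
open import Data.List.Relation.Unary.All using (All)
open import Data.Product using (∃; _×_)
open import Data.Sum using (_⊎_)
open import Relation.Binary.PropositionalEquality using (_≡_; _≢_)

DigitSet : Set₁
DigitSet = ℕ → Set

data LastNonZero : List ℕ → Set where
  lnz-[]  : LastNonZero []
  lnz-one : ∀ {x} → x ≢ 0 → LastNonZero (x ∷ [])
  lnz-∷   : ∀ {x y ys} → LastNonZero (y ∷ ys) → LastNonZero (x ∷ y ∷ ys)

value : ℕ → List ℕ → ℕ
value n []       = 0
value n (α ∷ αs) = α + n * value n αs

IsExpansion : ℕ → DigitSet → ℕ → List ℕ → Set
IsExpansion n D k αs = All D αs × LastNonZero αs × value n αs ≡ k

Uniqueness : ℕ → DigitSet → Set
Uniqueness n D = ∀ k αs βs → IsExpansion n D k αs → IsExpansion n D k βs → αs ≡ βs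

WeakUniqueness : ℕ → DigitSet → Set
WeakUniqueness n D = ∀ k l αs βs → IsExpansion n D k αs → IsExpansion n D l βs →
  length αs ≡ length βs → αs ≢ βs → k ≢ l

SetOf : ∀ {m} → (Fin m → ℕ) → DigitSet
SetOf a x = ∃ λ i → a i ≡ x

-- B = {0, a₂ − a₁, …, a_m − a₁}  (a : Fin (suc k) → ℕ, a fzero = a₁)
ShiftedSet : ∀ {k} → (Fin (suc k) → ℕ) → DigitSet
ShiftedSet a x = (x ≡ 0) ⊎ (∃ λ i → a (fsuc i) ∸ a fzero ≡ x)

StrictlyIncreasing : ∀ {m} → (Fin m → ℕ) → Set
StrictlyIncreasing a = ∀ i j → i <ᶠ j → a i < a j

-- Subtracting a₁ from every digit of an A-tuple of length L lowers its value by
-- the fixed amount a₁(1 + n + ⋯ + n^(L-1)), so on tuples of equal length the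
-- value is injective for A exactly when it is injective for B.  Since no digit of
-- A is 0, every A-tuple is an A-expansion, so weak uniqueness of A is this
-- injectivity.  Since 0 ∈ B, every B-tuple is a B-expansion padded with zeros
-- (and tuples can be padded to a common length), so uniqueness of B is the same
-- injectivity for B.
module Submission where

open import Defs
open import Data.Nat using (ℕ; zero; suc; _+_; _*_; _≤_; _<_; z≤n; s≤s; _≟_)
open import Data.Nat.Properties
  using (≤-refl; <⇒≤; <⇒≢; <-≤-trans; m+[n∸m]≡n; +-identityʳ; +-comm; +-cancelˡ-≡; +-cancelʳ-≡; *-zeroʳ)
open import Data.Nat.Solver using (module +-*-Solver)
open import Data.Fin using (Fin) renaming (zero to fzero; suc to fsuc)
open import Data.List using (List; []; _∷_; length; map; replicate; _++_)
open import Data.List.Properties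
  using (map-injective; ∷-injectiveˡ; ∷-injectiveʳ; length-map; length-++; length-replicate; ≡-dec)
open import Data.List.Relation.Unary.All as All using (All; []; _∷_)
open import Data.List.Relation.Unary.All.Properties using (++⁺; ++⁻ˡ; replicate⁺; map⁺)
open import Data.Product using (∃; ∃₂; _×_; _,_)
open import Data.Sum using (inj₁; inj₂)
open import Data.Empty using (⊥-elim)
open import Function.Bundles using (_⇔_; mk⇔; Equivalence)
open import Function.Properties.Equivalence using () renaming (sym to ⇔-sym; trans to ⇔-trans)
open import Relation.Nullary.Decidable using (decidable-stable)
open import Relation.Binary.PropositionalEquality
  using (_≡_; _≢_; refl; sym; trans; cong; cong₂; module ≡-Reasoning)

ValueInjective : ℕ → DigitSet → Set
ValueInjective n D = ∀ {αs βs} → All D αs → All D βs →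
  length αs ≡ length βs → value n αs ≡ value n βs → αs ≡ βs

value-replicate-0 : ∀ n j → value n (replicate j 0) ≡ 0
value-replicate-0 n zero    = refl
value-replicate-0 n (suc j) = trans (cong (n *_) (value-replicate-0 n j)) (*-zeroʳ n)

value-++-replicate-0 : ∀ n xs j → value n (xs ++ replicate j 0) ≡ value n xs
value-++-replicate-0 n []       j = value-replicate-0 n j
value-++-replicate-0 n (x ∷ xs) j = cong (λ v → x + n * v) (value-++-replicate-0 n xs j)

value-map-+ : ∀ n c xs →
  value n (map (c +_) xs) ≡ value n xs + value n (replicate (length xs) c)
value-map-+ n c []       = refl
value-map-+ n c (x ∷ xs) =
  trans (cong (λ v → c + x + n * v) (value-map-+ n c xs))
        (solve 5 (λ c x n v w → c :+ x :+ n :* (v :+ w) := (x :+ n :* v) :+ (c :+ n :* w))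
               refl c x n (value n xs) (value n (replicate (length xs) c)))
  where open +-*-Solver

value-map-+-≡ : ∀ n c xs ys → length xs ≡ length ys →
  value n (map (c +_) xs) ≡ value n (map (c +_) ys) ⇔ value n xs ≡ value n ys
value-map-+-≡ n c xs ys len = mk⇔
  (λ eq → +-cancelʳ-≡ offset _ _ (trans (sym shifted-xs) (trans eq shifted-ys)))
  (λ eq → trans shifted-xs (trans (cong (_+ offset) eq) (sym shifted-ys)))
  where
  offset : ℕ
  offset = value n (replicate (length ys) c)
  shifted-xs : value n (map (c +_) xs) ≡ value n xs + offset
  shifted-xs = trans (value-map-+ n c xs) (cong (λ L → value n xs + value n (replicate L c)) len)
  shifted-ys : value n (map (c +_) ys) ≡ value n ys + offset
  shifted-ys = value-map-+ n c ys

module _ {n c : ℕ} {D E : DigitSet}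
         (shift : ∀ {x} → D x → E (c + x))
         (unshift : ∀ {y} → E y → ∃ λ x → D x × c + x ≡ y) where

  unshift-all : ∀ {ys} → All E ys → ∃ λ xs → All D xs × map (c +_) xs ≡ ys
  unshift-all []       = [] , [] , refl
  unshift-all (e ∷ es) with unshift e | unshift-all es
  ... | x , d , refl | xs , ds , refl = x ∷ xs , d ∷ ds , refl

  ValueInjective-translate : ValueInjective n D ⇔ ValueInjective n E
  ValueInjective-translate = mk⇔ to from
    where
    to : ValueInjective n D → ValueInjective n E
    to inj es fs len veq with unshift-all es | unshift-all fs
    ... | xs , ds , refl | ys , ds′ , refl =
      cong (map (c +_)) (inj ds ds′ len′ (Equivalence.to (value-map-+-≡ n c xs ys len′) veq))
      where
      len′ : length xs ≡ length ys
      len′ = trans (sym (length-map (c +_) xs)) (trans len (length-map (c +_) ys))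

    from : ValueInjective n E → ValueInjective n D
    from inj {xs} {ys} ds ds′ len veq =
      map-injective (+-cancelˡ-≡ c _ _)
        (inj (map⁺ (All.map shift ds))
             (map⁺ (All.map shift ds′))
             (trans (length-map (c +_) xs) (trans len (sym (length-map (c +_) ys))))
             (Equivalence.from (value-map-+-≡ n c xs ys len) veq))

length-++-replicate : ∀ xs j → length (xs ++ replicate j 0) ≡ length xs + j
length-++-replicate xs j = trans (length-++ xs) (cong (length xs +_) (length-replicate j))

split-trailing-zeros : ∀ xs → ∃₂ λ ys j → LastNonZero ys × ys ++ replicate j 0 ≡ xs
split-trailing-zeros [] = [] , 0 , lnz-[] , refl
split-trailing-zeros (x ∷ xs) with split-trailing-zeros xs | x
... | y ∷ ys , j , l , refl | x     = x ∷ y ∷ ys , j , lnz-∷ l , refl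
... | []     , j , _ , refl | zero  = [] , suc j , lnz-[] , refl
... | []     , j , _ , refl | suc x = suc x ∷ [] , j , lnz-one (λ ()) , refl

zeros≢lastNonZero-++-zeros : ∀ {z zs} i j → LastNonZero (z ∷ zs) →
  replicate i 0 ≢ (z ∷ zs) ++ replicate j 0
zeros≢lastNonZero-++-zeros zero    j _           ()
zeros≢lastNonZero-++-zeros (suc i) j (lnz-one z≢0) eq = z≢0 (sym (∷-injectiveˡ eq))
zeros≢lastNonZero-++-zeros (suc i) j (lnz-∷ l)     eq =
  zeros≢lastNonZero-++-zeros i j l (∷-injectiveʳ eq)

++-zeros-cancel : ∀ {ys zs} i j → LastNonZero ys → LastNonZero zs →
  ys ++ replicate i 0 ≡ zs ++ replicate j 0 → ys ≡ zs
++-zeros-cancel i j lnz-[] lnz-[] eq = refl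
++-zeros-cancel i j lnz-[] l@(lnz-one _) eq = ⊥-elim (zeros≢lastNonZero-++-zeros i j l eq)
++-zeros-cancel i j lnz-[] l@(lnz-∷ _)   eq = ⊥-elim (zeros≢lastNonZero-++-zeros i j l eq)
++-zeros-cancel i j l@(lnz-one _) lnz-[] eq = ⊥-elim (zeros≢lastNonZero-++-zeros j i l (sym eq))
++-zeros-cancel i j l@(lnz-∷ _)   lnz-[] eq = ⊥-elim (zeros≢lastNonZero-++-zeros j i l (sym eq))
++-zeros-cancel i j (lnz-one _) (lnz-one _) eq = cong (_∷ []) (∷-injectiveˡ eq)
++-zeros-cancel i j (lnz-one _) (lnz-∷ l) eq =
  ⊥-elim (zeros≢lastNonZero-++-zeros i j l (∷-injectiveʳ eq))
++-zeros-cancel i j (lnz-∷ l) (lnz-one _) eq =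
  ⊥-elim (zeros≢lastNonZero-++-zeros j i l (sym (∷-injectiveʳ eq)))
++-zeros-cancel i j (lnz-∷ l) (lnz-∷ l′) eq =
  cong₂ _∷_ (∷-injectiveˡ eq) (++-zeros-cancel i j l l′ (∷-injectiveʳ eq))

module _ {n : ℕ} {D : DigitSet} (D0 : D 0) where

  Uniqueness⇔ValueInjective : Uniqueness n D ⇔ ValueInjective n D
  Uniqueness⇔ValueInjective = mk⇔ to from
    where
    to : Uniqueness n D → ValueInjective n D
    to uniq {αs} {βs} ds ds′ len veq
      with split-trailing-zeros αs | split-trailing-zeros βs
    ... | ys , i , l , refl | zs , j , l′ , refl = cong₂ (λ ws k → ws ++ replicate k 0) ys≡zs i≡j
      where
      ys≡zs : ys ≡ zs
      ys≡zs = uniq (value n ys) ys zs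
        (++⁻ˡ ys ds , l , refl)
        (++⁻ˡ zs ds′ , l′ , trans (sym (value-++-replicate-0 n zs j))
                              (trans (sym veq) (value-++-replicate-0 n ys i)))
      i≡j : i ≡ j
      i≡j = +-cancelˡ-≡ (length ys) i j (begin
        length ys + i                ≡⟨ sym (length-++-replicate ys i) ⟩
        length (ys ++ replicate i 0) ≡⟨ len ⟩
        length (zs ++ replicate j 0) ≡⟨ length-++-replicate zs j ⟩
        length zs + j                ≡⟨ cong (_+ j) (cong length (sym ys≡zs)) ⟩
        length ys + j                ∎)
        where open ≡-Reasoning

    from : ValueInjective n D → Uniqueness n D
    from inj k αs βs (ds , l , refl) (ds′ , l′ , vβ) =
      ++-zeros-cancel (length βs) (length αs) l l′
        (inj (++⁺ ds (replicate⁺ _ D0)) (++⁺ ds′ (replicate⁺ _ D0))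
             (trans (length-++-replicate αs (length βs))
               (trans (+-comm (length αs) (length βs)) (sym (length-++-replicate βs (length αs)))))
             (trans (value-++-replicate-0 n αs _)
                    (trans (sym vβ) (sym (value-++-replicate-0 n βs _)))))

All-nonzero⇒LastNonZero : ∀ {D : DigitSet} → (∀ {x} → D x → x ≢ 0) →
  ∀ {xs} → All D xs → LastNonZero xs
All-nonzero⇒LastNonZero nz []                = lnz-[]
All-nonzero⇒LastNonZero nz (d ∷ [])          = lnz-one (nz d)
All-nonzero⇒LastNonZero nz (_ ∷ ds@(_ ∷ _))  = lnz-∷ (All-nonzero⇒LastNonZero nz ds)

WeakUniqueness⇔ValueInjective : ∀ {n} {D : DigitSet} → (∀ {x} → D x → x ≢ 0) →
  WeakUniqueness n D ⇔ ValueInjective n D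
WeakUniqueness⇔ValueInjective {n} nz = mk⇔
  (λ weak {αs} {βs} ds ds′ len veq → decidable-stable (≡-dec _≟_ αs βs) λ αs≢βs →
     weak _ _ αs βs (ds , All-nonzero⇒LastNonZero nz ds , refl)
                    (ds′ , All-nonzero⇒LastNonZero nz ds′ , refl) len αs≢βs veq)
  (λ { inj k l αs βs (ds , _ , refl) (ds′ , _ , refl) len αs≢βs veq → αs≢βs (inj ds ds′ len veq) })

proposition6 : (n : ℕ) → 2 ≤ n → (k : ℕ) → (a : Fin (suc k) → ℕ) →
                 0 < a fzero → StrictlyIncreasing a →
                 WeakUniqueness n (SetOf a) ⇔ Uniqueness n (ShiftedSet a)
proposition6 n _ k a a₁>0 increasing =
  ⇔-trans (WeakUniqueness⇔ValueInjective nonzero)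
    (⇔-trans (⇔-sym (ValueInjective-translate shift unshift))
             (⇔-sym (Uniqueness⇔ValueInjective (inj₁ refl))))
  where
  a₁≤ : ∀ i → a fzero ≤ a i
  a₁≤ fzero    = ≤-refl
  a₁≤ (fsuc i) = <⇒≤ (increasing fzero (fsuc i) (s≤s z≤n))

  nonzero : ∀ {x} → SetOf a x → x ≢ 0
  nonzero (i , refl) ai≡0 = <⇒≢ (<-≤-trans a₁>0 (a₁≤ i)) (sym ai≡0)

  shift : ∀ {x} → ShiftedSet a x → SetOf a (a fzero + x)
  shift (inj₁ refl)       = fzero , sym (+-identityʳ (a fzero))
  shift (inj₂ (i , refl)) = fsuc i , sym (m+[n∸m]≡n (a₁≤ (fsuc i)))

  unshift : ∀ {y} → SetOf a y → ∃ λ x → ShiftedSet a x × a fzero + x ≡ y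
  unshift (fzero  , refl) = 0 , inj₁ refl , +-identityʳ (a fzero)
  unshift (fsuc i , refl) = _ , inj₂ (i , refl) , m+[n∸m]≡n (a₁≤ (fsuc i))
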